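{- For every positive integer $n$, the expected number of leaves in a labeled non-plane 1-2 tree on vertex set $[n]$ chosen uniformly at random is at least $n/4$.
   Context: A labeled non-plane 1-2 tree on vertex set $[n]=\{1,\dots,n\}$ is a rooted tree whose vertices are bijectively labeled by $[n]$, in which every vertex has at most two children, the label of each non-root vertex is less than the label of its parent, and the children of a vertex are unordered. A leaf is a vertex with no children. -}

module Defs where

open import Data.Nat using (ℕ; zero; suc; _<ᵇ_; _≤ᵇ_; _≡ᵇ_)
open import Data.Fin using (Fin; toℕ)
open import Data.Fin.Properties using (_≟_)
open import Data.Bool using (Bool; true; false; _∧_)
open import Data.Maybe using (Maybe; just; nothing)
open import Data.List using (List; []; _∷_; map; concatMap; filterᵇ; length; sum; allFin)
open import Data.List.Relation.Unary.All using (All)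
open import Data.Vec using (Vec; []; _∷_; lookup)
open import Relation.Nullary.Decidable using (⌊_⌋)
open import Relation.Binary.PropositionalEquality using (_≡_)

-- A rooted tree on the vertex set [n] is encoded by its parent map:
-- vertex i : Fin n (carrying label toℕ i + 1) is sent to  just p  (its parent p)
-- or to  nothing  (i is the root).  The parent map determines the rooted tree
-- and, children being unordered, this is exactly a non-plane tree.
ParentMap : ℕ → Set
ParentMap n = Vec (Maybe (Fin n)) n

allVecs : {A : Set} → List A → (k : ℕ) → List (Vec A k)
allVecs xs zero    = [] ∷ []
allVecs xs (suc k) = concatMap (λ x → map (x ∷_) (allVecs xs k)) xs

allMaybeFin : (n : ℕ) → List (Maybe (Fin n))
allMaybeFin n = nothing ∷ map just (allFin n)

allParentMaps : (n : ℕ) → List (ParentMap n)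
allParentMaps n = allVecs (allMaybeFin n) n

isRoot : {n : ℕ} → ParentMap n → Fin n → Bool
isRoot v i with lookup v i
... | nothing = true
... | just _  = false

isChildOf : {n : ℕ} → ParentMap n → Fin n → Fin n → Bool
isChildOf v j i with lookup v i
... | nothing = false
... | just p  = ⌊ p ≟ j ⌋

decreasingAt : {n : ℕ} → ParentMap n → Fin n → Bool
decreasingAt v i with lookup v i
... | nothing = true
... | just p  = toℕ i <ᵇ toℕ p

numChildren : {n : ℕ} → ParentMap n → Fin n → ℕ
numChildren {n} v j = length (filterᵇ (isChildOf v j) (allFin n))

allB : {n : ℕ} → (Fin n → Bool) → Bool
allB {n} f = Data.List.foldr (λ i b → f i ∧ b) true (allFin n)
  where import Data.List

-- A labeled non-plane 1-2 tree on [n]: exactly one root, every non-root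
-- vertex has a smaller label than its parent (hence no cycles, and every
-- vertex reaches the root), and every vertex has at most two children.
isOneTwoTree : {n : ℕ} → ParentMap n → Bool
isOneTwoTree {n} v =
  (length (filterᵇ (isRoot v) (allFin n)) ≡ᵇ 1)
  ∧ allB (decreasingAt v)
  ∧ allB (λ j → numChildren v j ≤ᵇ 2)

oneTwoTrees : (n : ℕ) → List (ParentMap n)
oneTwoTrees n = filterᵇ isOneTwoTree (allParentMaps n)

numLeaves : {n : ℕ} → ParentMap n → ℕ
numLeaves {n} v = length (filterᵇ (λ j → numChildren v j ≡ᵇ 0) (allFin n))

module Submission where

-- Vertex 1 of a 1-2 tree is always a leaf.  Removing it is a bijection from the
-- trees on [n+1] to the pairs (w , p) of a tree w on [n] and a vertex p of w with
-- at most one child; the inverse grafts vertex 1 below p.  Grafting below a leaf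
-- keeps the number L of leaves and adds a unary vertex, grafting below a unary
-- vertex adds a leaf and removes a unary vertex; hence 2L + U = n + 1 throughout.
-- Weighting a tree by 2^(n−L) turns this into exact recurrences for
-- X_n = Σ 2^(n−L) and Y_n = Σ 2^(n−L)·L, which give n·X_n ≤ 4·Y_n by induction:
-- the weighted mean of L is at least n/4.  The weights decrease with L, so by
-- Chebyshev's sum inequality the plain mean of L is at least the weighted mean.

open import Defs
open import Data.Nat.Properties hiding (_≟_)
open import Algebra.Properties.Semiring.Sum +-*-semiring
  using (sum-syntax; ∑-distrib-+; *-distribʳ-sum; sum-cong-≗; sum-replicate-zero)
open import Data.Bool using (Bool; true; false; _∧_; not; T)
open import Data.Bool.Properties using (T-∧)
open import Data.Empty using (⊥-elim)
open import Data.Fin using (Fin; zero; suc; toℕ; fromℕ)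
import Data.Fin as Fin
open import Data.Fin.Properties using (_≟_; toℕ-fromℕ; toℕ≤pred[n])
import Data.Fin.Properties
open import Data.List using (List; []; _∷_; _++_; map; length; filterᵇ; concatMap; tabulate; allFin; foldr)
open import Data.List.Properties using (map-cong; map-cong-local; map-∘; map-++; map-tabulate; tabulate-cong)
open import Data.List.Relation.Unary.All using (All; []; _∷_)
import Data.List.Relation.Unary.All as All
open import Data.Maybe using (Maybe; just; nothing)
import Data.Maybe as M
open import Data.Nat using (ℕ; zero; suc; _+_; _*_; _∸_; _^_; _≤_; _<_; _>_; z≤n; s≤s; _≤ᵇ_; _<ᵇ_; _≡ᵇ_; >-nonZero)
open import Data.Nat using () renaming (_≟_ to _≟ℕ_)
open import Data.Nat.ListAction using (sum)
open import Data.Nat.ListAction.Properties using (sum-++)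
open import Data.Nat.Tactic.RingSolver using (solve-∀)
open import Data.Product using (_×_; _,_; proj₁; proj₂)
open import Data.Sum using (_⊎_; inj₁; inj₂)
open import Data.Unit using (tt)
open import Data.Vec using (Vec; _∷_; lookup)
import Data.Vec as V
open import Data.Vec.Properties using (lookup-map)
open import Function using (id; _∘_; _⇔_; mk⇔; Equivalence)
open import Relation.Binary.PropositionalEquality
open import Relation.Nullary using (yes; no; does)
open import Relation.Nullary.Decidable using (⌊_⌋)
open import Relation.Unary using (Decidable)

𝟙 : Bool → ℕ
𝟙 true  = 1
𝟙 false = 0

keepIf : Bool → ℕ → ℕ
keepIf true  x = x
keepIf false x = 0

keepIf-∧ : ∀ a b x → keepIf (a ∧ b) x ≡ keepIf a (keepIf b x)
keepIf-∧ true  b x = refl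
keepIf-∧ false b x = refl

module _ {A : Set} where

  sum-cong : {f g : A → ℕ} → (∀ x → f x ≡ g x) → (xs : List A) →
             sum (map f xs) ≡ sum (map g xs)
  sum-cong f≗g xs = cong sum (map-cong f≗g xs)

  sum-congAll : {f g : A → ℕ} {xs : List A} → All (λ x → f x ≡ g x) xs →
                sum (map f xs) ≡ sum (map g xs)
  sum-congAll eqs = cong sum (map-cong-local eqs)

  sum-const : (c : ℕ) (xs : List A) → sum (map (λ _ → c) xs) ≡ length xs * c
  sum-const c []       = refl
  sum-const c (x ∷ xs) = cong (c +_) (sum-const c xs)

  sum-zero : {f : A → ℕ} → (∀ x → f x ≡ 0) → (xs : List A) → sum (map f xs) ≡ 0
  sum-zero f≡0 xs = trans (sum-cong f≡0 xs) (trans (sum-const 0 xs) (*-zeroʳ (length xs)))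

  sum-zeroAll : {f : A → ℕ} {xs : List A} → All (λ x → f x ≡ 0) xs → sum (map f xs) ≡ 0
  sum-zeroAll {xs = xs} zeros = trans (sum-congAll zeros) (sum-zero (λ _ → refl) xs)

  sum-zero⁻ : {f : A → ℕ} (xs : List A) → sum (map f xs) ≡ 0 → All (λ x → f x ≡ 0) xs
  sum-zero⁻     []       _ = []
  sum-zero⁻ {f} (x ∷ xs) e = m+n≡0⇒m≡0 (f x) e ∷ sum-zero⁻ xs (m+n≡0⇒n≡0 (f x) e)

  sum-mono : {f g : A → ℕ} → (∀ x → f x ≤ g x) → (xs : List A) →
             sum (map f xs) ≤ sum (map g xs)
  sum-mono f≤g []       = z≤n
  sum-mono f≤g (x ∷ xs) = +-mono-≤ (f≤g x) (sum-mono f≤g xs)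

  sum-+ : (f g : A → ℕ) (xs : List A) →
          sum (map (λ x → f x + g x) xs) ≡ sum (map f xs) + sum (map g xs)
  sum-+ f g []       = refl
  sum-+ f g (x ∷ xs) = begin
    f x + g x + sum (map (λ y → f y + g y) xs)  ≡⟨ cong (f x + g x +_) (sum-+ f g xs) ⟩
    f x + g x + (F + G)                         ≡⟨ interchange (f x) (g x) F G ⟩
    f x + F + (g x + G)                         ∎
    where
    open ≡-Reasoning
    F = sum (map f xs)
    G = sum (map g xs)
    interchange : ∀ a b c d → a + b + (c + d) ≡ a + c + (b + d)
    interchange = solve-∀

  sum-*ˡ : (c : ℕ) (f : A → ℕ) (xs : List A) →
           sum (map (λ x → c * f x) xs) ≡ c * sum (map f xs)
  sum-*ˡ c f []       = sym (*-zeroʳ c)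
  sum-*ˡ c f (x ∷ xs) = trans (cong (c * f x +_) (sum-*ˡ c f xs)) (sym (*-distribˡ-+ c (f x) _))

  sum-*ʳ : (c : ℕ) (f : A → ℕ) (xs : List A) →
           sum (map (λ x → f x * c) xs) ≡ sum (map f xs) * c
  sum-*ʳ c f xs = trans (sum-cong (λ x → *-comm (f x) c) xs)
                        (trans (sum-*ˡ c f xs) (*-comm c _))

  sum-filterᵇ : (p : A → Bool) (f : A → ℕ) (xs : List A) →
                sum (map f (filterᵇ p xs)) ≡ sum (map (λ x → keepIf (p x) (f x)) xs)
  sum-filterᵇ p f []       = refl
  sum-filterᵇ p f (x ∷ xs) with p x
  ... | true  = cong (f x +_) (sum-filterᵇ p f xs)
  ... | false = sum-filterᵇ p f xs

  length-filterᵇ : (p : A → Bool) (xs : List A) →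
                   length (filterᵇ p xs) ≡ sum (map (𝟙 ∘ p) xs)
  length-filterᵇ p []       = refl
  length-filterᵇ p (x ∷ xs) with p x
  ... | true  = cong suc (length-filterᵇ p xs)
  ... | false = length-filterᵇ p xs

  keepIf-sum : (b : Bool) (f : A → ℕ) (xs : List A) →
               sum (map (λ x → keepIf b (f x)) xs) ≡ keepIf b (sum (map f xs))
  keepIf-sum true  f xs = refl
  keepIf-sum false f xs = sum-zero (λ _ → refl) xs

module _ {A B : Set} where

  sum-map : (g : B → ℕ) (f : A → B) (xs : List A) →
            sum (map g (map f xs)) ≡ sum (map (g ∘ f) xs)
  sum-map g f xs = cong sum (sym (map-∘ xs))

  sum-concatMap : (g : B → ℕ) (f : A → List B) (xs : List A) →
    sum (map g (concatMap f xs)) ≡ sum (map (λ x → sum (map g (f x))) xs)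
  sum-concatMap g f []       = refl
  sum-concatMap g f (x ∷ xs) = begin
    sum (map g (f x ++ concatMap f xs))
      ≡⟨ cong sum (map-++ g (f x) (concatMap f xs)) ⟩
    sum (map g (f x) ++ map g (concatMap f xs))
      ≡⟨ sum-++ (map g (f x)) _ ⟩
    sum (map g (f x)) + sum (map g (concatMap f xs))
      ≡⟨ cong (sum (map g (f x)) +_) (sum-concatMap g f xs) ⟩
    sum (map g (f x)) + sum (map (λ y → sum (map g (f y))) xs)  ∎
    where open ≡-Reasoning

  sum-swap : (f : A → B → ℕ) (xs : List A) (ys : List B) →
    sum (map (λ x → sum (map (f x) ys)) xs) ≡ sum (map (λ y → sum (map (λ x → f x y) xs)) ys)
  sum-swap f []       ys = sym (sum-zero (λ _ → refl) ys)
  sum-swap f (x ∷ xs) ys =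
    trans (cong (sum (map (f x) ys) +_) (sum-swap f xs ys))
          (sym (sum-+ (f x) (λ y → sum (map (λ x' → f x' y) xs)) ys))

module _ {A : Set} where

  sum-allVecs-suc : (xs : List A) (k : ℕ) (g : Vec A (suc k) → ℕ) →
    sum (map g (allVecs xs (suc k))) ≡ sum (map (λ x → sum (map (λ v → g (x ∷ v)) (allVecs xs k))) xs)
  sum-allVecs-suc xs k g =
    trans (sum-concatMap g (λ x → map (x ∷_) (allVecs xs k)) xs)
          (sum-cong (λ x → sum-map g (x ∷_) (allVecs xs k)) xs)

  sum-allVecs-avoid : (a y : A) (xs : List A) (k : ℕ) (g : Vec A k → ℕ) →
    (∀ v i → lookup v i ≡ y → g v ≡ 0) →
    sum (map g (allVecs (a ∷ y ∷ xs) k)) ≡ sum (map g (allVecs (a ∷ xs) k))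
  sum-allVecs-avoid a y xs zero    g vanish = refl
  sum-allVecs-avoid a y xs (suc k) g vanish = begin
    sum (map g (allVecs (a ∷ y ∷ xs) (suc k)))
      ≡⟨ sum-allVecs-suc (a ∷ y ∷ xs) k g ⟩
    sum (map (λ x → sum (map (λ v → g (x ∷ v)) (allVecs (a ∷ y ∷ xs) k))) (a ∷ y ∷ xs))
      ≡⟨ sum-cong shorter (a ∷ y ∷ xs) ⟩
    tails a + (tails y + sum (map tails xs))
      ≡⟨ cong (λ t → tails a + (t + sum (map tails xs)))
              (sum-zero (λ v → vanish (y ∷ v) zero refl) (allVecs (a ∷ xs) k)) ⟩
    tails a + sum (map tails xs)
      ≡⟨ sym (sum-allVecs-suc (a ∷ xs) k g) ⟩
    sum (map g (allVecs (a ∷ xs) (suc k)))  ∎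
    where
    open ≡-Reasoning
    tails : A → ℕ
    tails x = sum (map (λ v → g (x ∷ v)) (allVecs (a ∷ xs) k))
    shorter : ∀ x → sum (map (λ v → g (x ∷ v)) (allVecs (a ∷ y ∷ xs) k)) ≡ tails x
    shorter x = sum-allVecs-avoid a y xs k (λ v → g (x ∷ v)) (λ v i e → vanish (x ∷ v) (suc i) e)

module _ {A B : Set} where

  sum-allVecs-map : (h : A → B) (xs : List A) (k : ℕ) (g : Vec B k → ℕ) →
    sum (map g (allVecs (map h xs) k)) ≡ sum (map (g ∘ V.map h) (allVecs xs k))
  sum-allVecs-map h xs zero    g = refl
  sum-allVecs-map h xs (suc k) g = begin
    sum (map g (allVecs (map h xs) (suc k)))
      ≡⟨ sum-allVecs-suc (map h xs) k g ⟩
    sum (map (λ y → sum (map (λ v → g (y ∷ v)) (allVecs (map h xs) k))) (map h xs))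
      ≡⟨ sum-map _ h xs ⟩
    sum (map (λ x → sum (map (λ v → g (h x ∷ v)) (allVecs (map h xs) k))) xs)
      ≡⟨ sum-cong (λ x → sum-allVecs-map h xs k (λ v → g (h x ∷ v))) xs ⟩
    sum (map (λ x → sum (map (λ v → g (h x ∷ V.map h v)) (allVecs xs k))) xs)
      ≡⟨ sym (sum-allVecs-suc xs k (g ∘ V.map h)) ⟩
    sum (map (g ∘ V.map h) (allVecs xs (suc k)))  ∎
    where open ≡-Reasoning

sum-tabulate : ∀ {n} (f : Fin n → ℕ) → sum (tabulate f) ≡ ∑[ i < n ] f i
sum-tabulate {zero}  f = refl
sum-tabulate {suc n} f = cong (f zero +_) (sum-tabulate (f ∘ suc))

sum-allFin : ∀ n (f : Fin n → ℕ) → sum (map f (allFin n)) ≡ ∑[ i < n ] f i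
sum-allFin n f = trans (cong sum (map-tabulate id f)) (sum-tabulate f)

∑-zero⁻ : ∀ {n} (f : Fin n → ℕ) → ∑[ i < n ] f i ≡ 0 → ∀ i → f i ≡ 0
∑-zero⁻ f e zero    = m+n≡0⇒m≡0 (f zero) e
∑-zero⁻ f e (suc i) = ∑-zero⁻ (f ∘ suc) (m+n≡0⇒n≡0 (f zero) e) i

∑-update : ∀ {n} (p : Fin n) (f g : Fin n → ℕ) → (∀ j → p ≢ j → f j ≡ g j) →
           ∑[ i < n ] f i + g p ≡ ∑[ i < n ] g i + f p
∑-update {suc n} zero f g agree =
  begin
    f zero + F + g zero  ≡⟨ cong (λ x → f zero + x + g zero) F≡G ⟩
    f zero + G + g zero  ≡⟨ swap-ends (f zero) G (g zero) ⟩
    g zero + G + f zero  ∎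
  where
  open ≡-Reasoning
  F = ∑[ i < n ] f (suc i)
  G = ∑[ i < n ] g (suc i)
  F≡G : F ≡ G
  F≡G = sum-cong-≗ (λ j → agree (suc j) (λ ()))
  swap-ends : ∀ a x b → a + x + b ≡ b + x + a
  swap-ends = solve-∀
∑-update {suc n} (suc p) f g agree =
  begin
    f zero + F + g (suc p)    ≡⟨ cong (λ x → x + F + g (suc p)) (agree zero (λ ())) ⟩
    g zero + F + g (suc p)    ≡⟨ +-assoc (g zero) F _ ⟩
    g zero + (F + g (suc p))  ≡⟨ cong (g zero +_) (∑-update p (f ∘ suc) (g ∘ suc) agree′) ⟩
    g zero + (G + f (suc p))  ≡⟨ sym (+-assoc (g zero) G _) ⟩
    g zero + G + f (suc p)    ∎
  where
  open ≡-Reasoning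
  F = ∑[ i < n ] f (suc i)
  G = ∑[ i < n ] g (suc i)
  agree′ : ∀ j → p ≢ j → f (suc j) ≡ g (suc j)
  agree′ j p≢j = agree (suc j) (λ e → p≢j (Data.Fin.Properties.suc-injective e))

count : ∀ {n} → (Fin n → Bool) → ℕ
count {n} p = ∑[ i < n ] 𝟙 (p i)

length-filter-allFin : ∀ {n} (p : Fin n → Bool) → length (filterᵇ p (allFin n)) ≡ count p
length-filter-allFin {n} p = trans (length-filterᵇ p (allFin n)) (sum-allFin n (𝟙 ∘ p))

T-allB : ∀ {n} (f : Fin n → Bool) → T (allB f) ⇔ (∀ i → T (f i))
T-allB f = allOn id
  where
  allOn : ∀ {m} (g : Fin m → _) → T (foldr (λ i b → f i ∧ b) true (tabulate g)) ⇔ (∀ i → T (f (g i)))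
  allOn {zero}  g = mk⇔ (λ _ ()) (λ _ → tt)
  allOn {suc m} g = mk⇔ to from
    where
    rest = allOn (g ∘ suc)
    to : T (f (g zero) ∧ foldr (λ i b → f i ∧ b) true (tabulate (g ∘ suc))) → ∀ i → T (f (g i))
    to t zero    = proj₁ (Equivalence.to T-∧ t)
    to t (suc i) = Equivalence.to rest (proj₂ (Equivalence.to T-∧ t)) i
    from : (∀ i → T (f (g i))) → T (f (g zero) ∧ foldr (λ i b → f i ∧ b) true (tabulate (g ∘ suc)))
    from h = Equivalence.from T-∧ (h zero , Equivalence.from rest (h ∘ suc))

T-ext : ∀ {a b : Bool} → (T a → T b) → (T b → T a) → a ≡ b
T-ext {false} {false} _ _ = refl
T-ext {false} {true}  _ g = ⊥-elim (g tt)
T-ext {true}  {false} f _ = ⊥-elim (f tt)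
T-ext {true}  {true}  _ _ = refl

-- The predicates of Defs inspect a parent map v only through the entry
-- lookup v i; parentIs / noParent / belowParent are those predicates as
-- functions of the entry, which makes them easy to transport along relabellings.
parentIs : ∀ {n} → Fin n → Maybe (Fin n) → Bool
parentIs j nothing  = false
parentIs j (just p) = ⌊ p ≟ j ⌋

noParent : ∀ {n} → Maybe (Fin n) → Bool
noParent nothing  = true
noParent (just _) = false

belowParent : ∀ {n} → ℕ → Maybe (Fin n) → Bool
belowParent a nothing  = true
belowParent a (just p) = a <ᵇ toℕ p

isChildOf-view : ∀ {n} (v : ParentMap n) j i → isChildOf v j i ≡ parentIs j (lookup v i)
isChildOf-view v j i with lookup v i
... | nothing = refl
... | just _  = refl

isRoot-view : ∀ {n} (v : ParentMap n) i → isRoot v i ≡ noParent (lookup v i)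
isRoot-view v i with lookup v i
... | nothing = refl
... | just _  = refl

decreasingAt-view : ∀ {n} (v : ParentMap n) i → decreasingAt v i ≡ belowParent (toℕ i) (lookup v i)
decreasingAt-view v i with lookup v i
... | nothing = refl
... | just _  = refl

numChildren-view : ∀ {n} (v : ParentMap n) j → numChildren v j ≡ count (λ i → parentIs j (lookup v i))
numChildren-view v j =
  trans (length-filter-allFin (isChildOf v j)) (sum-cong-≗ (cong 𝟙 ∘ isChildOf-view v j))

numRoots : ∀ {n} → ParentMap n → ℕ
numRoots {n} v = length (filterᵇ (isRoot v) (allFin n))

numRoots-view : ∀ {n} (v : ParentMap n) → numRoots v ≡ count (λ i → noParent (lookup v i))
numRoots-view v = trans (length-filter-allFin (isRoot v)) (sum-cong-≗ (cong 𝟙 ∘ isRoot-view v))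

numUnary : ∀ {n} → ParentMap n → ℕ
numUnary v = count (λ j → numChildren v j ≡ᵇ 1)

hasRoom : ∀ {n} → ParentMap n → Fin n → Bool
hasRoom w p = numChildren w p ≤ᵇ 1

atMostBinary : ∀ {n} → ParentMap n → Bool
atMostBinary v = allB (λ j → numChildren v j ≤ᵇ 2)

δ : ∀ {n} → Fin n → Fin n → ℕ
δ p j = 𝟙 ⌊ p ≟ j ⌋

δ-self : ∀ {n} (p : Fin n) → δ p p ≡ 1
δ-self p with p ≟ p
... | yes _  = refl
... | no p≢p = ⊥-elim (p≢p refl)

δ-≢ : ∀ {n} {p j : Fin n} → p ≢ j → δ p j ≡ 0
δ-≢ {p = p} {j} p≢j with p ≟ j
... | yes p≡j = ⊥-elim (p≢j p≡j)
... | no _    = refl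

-- Grafting: shift all labels of a parent map on [n] up by one and hang the
-- new vertex with label 1 (index zero) below p.  Every 1-2 tree on [n+1]
-- arises in this way (sum-over-trees-by-graft).
shift : ∀ {n} → ParentMap n → Vec (Maybe (Fin (suc n))) n
shift = V.map (M.map suc)

graft : ∀ {n} → ParentMap n → Fin n → ParentMap (suc n)
graft w p = just (suc p) ∷ shift w

lookup-shift : ∀ {n} (w : ParentMap n) i → lookup (shift w) i ≡ M.map suc (lookup w i)
lookup-shift w i = lookup-map i (M.map suc) w

parentIs-new : ∀ {n} (m : Maybe (Fin n)) → parentIs zero (M.map suc m) ≡ false
parentIs-new nothing  = refl
parentIs-new (just _) = refl

parentIs-shift : ∀ {n} (j : Fin n) (m : Maybe (Fin n)) → parentIs (suc j) (M.map suc m) ≡ parentIs j m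
parentIs-shift j nothing  = refl
parentIs-shift j (just q) with q ≟ j
... | yes _ = refl
... | no  _ = refl

δ-shift : ∀ {n} (p j : Fin n) → δ (suc p) (suc j) ≡ δ p j
δ-shift p j with p ≟ j
... | yes _ = refl
... | no  _ = refl

noParent-shift : ∀ {n} (m : Maybe (Fin n)) → noParent (M.map suc m) ≡ noParent m
noParent-shift nothing  = refl
noParent-shift (just _) = refl

belowParent-shift : ∀ {n} a (m : Maybe (Fin n)) → belowParent (suc a) (M.map suc m) ≡ belowParent a m
belowParent-shift a nothing  = refl
belowParent-shift a (just _) = refl

numChildren-graft-new : ∀ {n} (w : ParentMap n) p → numChildren (graft w p) zero ≡ 0
numChildren-graft-new {n} w p = begin
  numChildren (graft w p) zero                                   ≡⟨ numChildren-view (graft w p) zero ⟩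
  ∑[ i < n ] 𝟙 (parentIs zero (lookup (shift w) i))              ≡⟨ sum-cong-≗ noChild ⟩
  ∑[ i < n ] 0                                                   ≡⟨ sum-replicate-zero n ⟩
  0                                                              ∎
  where
  open ≡-Reasoning
  noChild : ∀ i → 𝟙 (parentIs zero (lookup (shift w) i)) ≡ 0
  noChild i = cong 𝟙 (trans (cong (parentIs zero) (lookup-shift w i)) (parentIs-new (lookup w i)))

numChildren-graft-old : ∀ {n} (w : ParentMap n) p j →
  numChildren (graft w p) (suc j) ≡ δ p j + numChildren w j
numChildren-graft-old w p j =
  trans (numChildren-view (graft w p) (suc j))
        (cong₂ _+_ (δ-shift p j)
                   (trans (sum-cong-≗ unchanged) (sym (numChildren-view w j))))
  where
  unchanged : ∀ i → 𝟙 (parentIs (suc j) (lookup (shift w) i)) ≡ 𝟙 (parentIs j (lookup w i))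
  unchanged i = cong 𝟙 (trans (cong (parentIs (suc j)) (lookup-shift w i)) (parentIs-shift j (lookup w i)))

numRoots-graft : ∀ {n} (w : ParentMap n) p → numRoots (graft w p) ≡ numRoots w
numRoots-graft w p =
  trans (numRoots-view (graft w p))
        (trans (sum-cong-≗ unchanged) (sym (numRoots-view w)))
  where
  unchanged : ∀ i → 𝟙 (noParent (lookup (shift w) i)) ≡ 𝟙 (noParent (lookup w i))
  unchanged i = cong 𝟙 (trans (cong noParent (lookup-shift w i)) (noParent-shift (lookup w i)))

decreasingAt-graft : ∀ {n} (w : ParentMap n) p i → decreasingAt (graft w p) (suc i) ≡ decreasingAt w i
decreasingAt-graft w p i = begin
  decreasingAt (graft w p) (suc i)                        ≡⟨ decreasingAt-view (graft w p) (suc i) ⟩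
  belowParent (suc (toℕ i)) (lookup (shift w) i)          ≡⟨ cong (belowParent (suc (toℕ i))) (lookup-shift w i) ⟩
  belowParent (suc (toℕ i)) (M.map suc (lookup w i))      ≡⟨ belowParent-shift (toℕ i) (lookup w i) ⟩
  belowParent (toℕ i) (lookup w i)                        ≡⟨ sym (decreasingAt-view w i) ⟩
  decreasingAt w i                                        ∎
  where open ≡-Reasoning

-- Hence grafting keeps it everywhere: at the new vertex it holds because
-- label 1 is the smallest.
allDecreasing-graft : ∀ {n} (w : ParentMap n) p → allB (decreasingAt (graft w p)) ≡ allB (decreasingAt w)
allDecreasing-graft w p = T-ext
  (λ t → from (T-allB (decreasingAt w)) λ i →
     subst T (decreasingAt-graft w p i) (to (T-allB (decreasingAt (graft w p))) t (suc i)))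
  (λ t → from (T-allB (decreasingAt (graft w p))) λ where
     zero    → tt
     (suc i) → subst T (sym (decreasingAt-graft w p i)) (to (T-allB (decreasingAt w)) t i))
  where open Equivalence

atMostBinary-graft : ∀ {n} (w : ParentMap n) p → atMostBinary (graft w p) ≡ atMostBinary w ∧ hasRoom w p
atMostBinary-graft w p = T-ext forward backward
  where
  open Equivalence
  after : ∀ j → T (atMostBinary (graft w p)) → δ p j + numChildren w j ≤ 2
  after j t = subst (_≤ 2) (numChildren-graft-old w p j)
                (≤ᵇ⇒≤ _ 2 (to (T-allB (λ j → numChildren (graft w p) j ≤ᵇ 2)) t (suc j)))
  forward : T (atMostBinary (graft w p)) → T (atMostBinary w ∧ hasRoom w p)
  forward t = from T-∧
    ( from (T-allB (λ j → numChildren w j ≤ᵇ 2)) (λ j → ≤⇒≤ᵇ (≤-trans (m≤n+m _ (δ p j)) (after j t)))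
    , ≤⇒≤ᵇ (+-cancelˡ-≤ 1 _ _ (subst (λ d → d + numChildren w p ≤ 2) (δ-self p) (after p t))))
  backward : T (atMostBinary w ∧ hasRoom w p) → T (atMostBinary (graft w p))
  backward t = from (T-allB (λ j → numChildren (graft w p) j ≤ᵇ 2)) bound
    where
    binary = to (T-allB (λ j → numChildren w j ≤ᵇ 2)) (proj₁ (to T-∧ t))
    room   = ≤ᵇ⇒≤ _ 1 (proj₂ (to T-∧ t))
    bound : ∀ j → T (numChildren (graft w p) j ≤ᵇ 2)
    bound zero = subst (λ c → T (c ≤ᵇ 2)) (sym (numChildren-graft-new w p)) tt
    bound (suc j) with p ≟ j | numChildren-graft-old w p j
    ... | yes refl | e = ≤⇒≤ᵇ (subst (_≤ 2) (sym e) (s≤s room))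
    ... | no  _    | e = ≤⇒≤ᵇ (subst (_≤ 2) (sym e) (≤ᵇ⇒≤ _ 2 (binary j)))

isOneTwoTree-graft : ∀ {n} (w : ParentMap n) p → isOneTwoTree (graft w p) ≡ isOneTwoTree w ∧ hasRoom w p
isOneTwoTree-graft w p
  rewrite numRoots-graft w p | allDecreasing-graft w p | atMostBinary-graft w p
  = reassoc (numRoots w ≡ᵇ 1) (allB (decreasingAt w)) (atMostBinary w) (hasRoom w p)
  where
  reassoc : ∀ a b c d → a ∧ b ∧ (c ∧ d) ≡ (a ∧ b ∧ c) ∧ d
  reassoc true  true  c d = refl
  reassoc true  false c d = refl
  reassoc false b     c d = refl

withDegree : ∀ {n} → ParentMap n → ℕ → ℕ
withDegree v b = count (λ j → numChildren v j ≡ᵇ b)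

numLeaves-withDegree : ∀ {n} (v : ParentMap n) → numLeaves v ≡ withDegree v 0
numLeaves-withDegree v = length-filter-allFin (λ j → numChildren v j ≡ᵇ 0)

-- Degree bookkeeping for a graft: the new vertex has 0 children, p passes from
-- c to c + 1 children, and every other vertex is unchanged.
withDegree-graft : ∀ {n} (w : ParentMap n) p b →
  withDegree (graft w p) b + 𝟙 (numChildren w p ≡ᵇ b)
    ≡ 𝟙 (0 ≡ᵇ b) + (withDegree w b + 𝟙 (suc (numChildren w p) ≡ᵇ b))
withDegree-graft {n} w p b = begin
  𝟙 (numChildren (graft w p) zero ≡ᵇ b) + ∑[ j < n ] 𝟙 (numChildren (graft w p) (suc j) ≡ᵇ b) + old p
    ≡⟨ cong (λ s → 𝟙 (numChildren (graft w p) zero ≡ᵇ b) + s + old p)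
            (sum-cong-≗ (λ j → cong (λ c → 𝟙 (c ≡ᵇ b)) (numChildren-graft-old w p j))) ⟩
  𝟙 (numChildren (graft w p) zero ≡ᵇ b) + ∑[ j < n ] new j + old p
    ≡⟨ cong (λ c → 𝟙 (c ≡ᵇ b) + ∑[ j < n ] new j + old p) (numChildren-graft-new w p) ⟩
  𝟙 (0 ≡ᵇ b) + ∑[ j < n ] new j + old p
    ≡⟨ +-assoc (𝟙 (0 ≡ᵇ b)) _ _ ⟩
  𝟙 (0 ≡ᵇ b) + (∑[ j < n ] new j + old p)
    ≡⟨ cong (𝟙 (0 ≡ᵇ b) +_) (∑-update p new old (λ j p≢j → cong (λ d → 𝟙 ((d + numChildren w j) ≡ᵇ b)) (δ-≢ p≢j))) ⟩
  𝟙 (0 ≡ᵇ b) + (withDegree w b + new p)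
    ≡⟨ cong (λ d → 𝟙 (0 ≡ᵇ b) + (withDegree w b + 𝟙 ((d + numChildren w p) ≡ᵇ b))) (δ-self p) ⟩
  𝟙 (0 ≡ᵇ b) + (withDegree w b + 𝟙 (suc (numChildren w p) ≡ᵇ b))  ∎
  where
  open ≡-Reasoning
  new old : Fin n → ℕ
  new j = 𝟙 ((δ p j + numChildren w j) ≡ᵇ b)
  old j = 𝟙 (numChildren w j ≡ᵇ b)

graft-at-leaf : ∀ {n} (w : ParentMap n) p → numChildren w p ≡ 0 →
  numLeaves (graft w p) ≡ numLeaves w × numUnary (graft w p) ≡ suc (numUnary w)
graft-at-leaf w p c≡0 with withDegree-graft w p 0 | withDegree-graft w p 1
... | leaves | unary rewrite c≡0 =
    trans (numLeaves-withDegree (graft w p))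
          (trans (suc-injective (trans (+-comm 1 _) (trans leaves (cong suc (+-identityʳ _)))))
                 (sym (numLeaves-withDegree w)))
  , trans (sym (+-identityʳ _)) (trans unary (+-comm _ 1))

graft-at-unary : ∀ {n} (w : ParentMap n) p → numChildren w p ≡ 1 →
  numLeaves (graft w p) ≡ suc (numLeaves w) × suc (numUnary (graft w p)) ≡ numUnary w
graft-at-unary w p c≡1 with withDegree-graft w p 0 | withDegree-graft w p 1
... | leaves | unary rewrite c≡1 =
    trans (numLeaves-withDegree (graft w p))
          (trans (sym (+-identityʳ _)) (trans leaves (cong suc (trans (+-identityʳ _) (sym (numLeaves-withDegree w))))))
  , trans (+-comm 1 _) (trans unary (+-identityʳ _))

keepIf-room : ∀ c x A B → (c ≡ 0 → x ≡ A) → (c ≡ 1 → x ≡ B) →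
              keepIf (c ≤ᵇ 1) x ≡ 𝟙 (c ≡ᵇ 0) * A + 𝟙 (c ≡ᵇ 1) * B
keepIf-room zero          x A B leaf unary = trans (leaf refl) (only-first A B)
  where only-first : ∀ A B → A ≡ 1 * A + 0 * B
        only-first = solve-∀
keepIf-room (suc zero)    x A B leaf unary = trans (unary refl) (only-second A B)
  where only-second : ∀ A B → B ≡ 0 * A + 1 * B
        only-second = solve-∀
keepIf-room (suc (suc c)) x A B leaf unary = refl

sum-over-room : ∀ {n} (w : ParentMap n) (G : ParentMap (suc n) → ℕ) (A B : ℕ) →
  (∀ p → numChildren w p ≡ 0 → G (graft w p) ≡ A) →
  (∀ p → numChildren w p ≡ 1 → G (graft w p) ≡ B) →
  sum (map (G ∘ graft w) (filterᵇ (hasRoom w) (allFin n))) ≡ numLeaves w * A + numUnary w * B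
sum-over-room {n} w G A B atLeaf atUnary = begin
  sum (map (G ∘ graft w) (filterᵇ (hasRoom w) (allFin n)))
    ≡⟨ sum-filterᵇ (hasRoom w) (G ∘ graft w) (allFin n) ⟩
  sum (map (λ p → keepIf (hasRoom w p) (G (graft w p))) (allFin n))
    ≡⟨ sum-allFin n _ ⟩
  ∑[ p < n ] keepIf (hasRoom w p) (G (graft w p))
    ≡⟨ sum-cong-≗ (λ p → keepIf-room (numChildren w p) _ A B (atLeaf p) (atUnary p)) ⟩
  ∑[ p < n ] (isLeaf p * A + isUnary p * B)
    ≡⟨ ∑-distrib-+ (λ p → isLeaf p * A) (λ p → isUnary p * B) ⟩
  ∑[ p < n ] (isLeaf p * A) + ∑[ p < n ] (isUnary p * B)
    ≡⟨ cong₂ _+_ (sym (*-distribʳ-sum A isLeaf)) (sym (*-distribʳ-sum B isUnary)) ⟩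
  withDegree w 0 * A + numUnary w * B
    ≡⟨ cong (λ l → l * A + numUnary w * B) (sym (numLeaves-withDegree w)) ⟩
  numLeaves w * A + numUnary w * B  ∎
  where
  open ≡-Reasoning
  isLeaf isUnary : Fin n → ℕ
  isLeaf  p = 𝟙 (numChildren w p ≡ᵇ 0)
  isUnary p = 𝟙 (numChildren w p ≡ᵇ 1)

decreasing-of-tree : ∀ {n} (v : ParentMap n) → T (isOneTwoTree v) → ∀ i → T (decreasingAt v i)
decreasing-of-tree v t =
  Equivalence.to (T-allB (decreasingAt v))
    (proj₁ (Equivalence.to T-∧ (proj₂ (Equivalence.to (T-∧ {numRoots v ≡ᵇ 1}) t))))

top-is-root : ∀ {n} (v : ParentMap (suc n)) → T (decreasingAt v (fromℕ n)) → lookup v (fromℕ n) ≡ nothing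
top-is-root {n} v t with lookup v (fromℕ n)
... | nothing = refl
... | just q  = ⊥-elim (<-irrefl refl (<-≤-trans n<q (toℕ≤pred[n] q)))
  where
  n<q : n < toℕ q
  n<q = subst (_< toℕ q) (toℕ-fromℕ n)
          (<ᵇ⇒< _ _ t)

-- Vertex 1 is not the root of a 1-2 tree on [n+2]: the top vertex is a root too.
vertex1-not-root : ∀ {n} (w : ParentMap (suc n)) → isOneTwoTree (nothing ∷ shift w) ≡ false
vertex1-not-root {n} w = T-ext (λ t → ⊥-elim (1≢0 (topCounted t))) (λ ())
  where
  v = nothing ∷ shift w
  1≢0 : 1 ≢ 0
  1≢0 ()
  topCounted : T (isOneTwoTree v) → 1 ≡ 0
  topCounted t = trans (sym (cong (𝟙 ∘ noParent) (top-is-root v (decreasing-of-tree v t (fromℕ (suc n))))))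
                       (∑-zero⁻ (λ i → 𝟙 (noParent (lookup (shift w) i))) otherRoots (fromℕ n))
    where
    otherRoots : count (λ i → noParent (lookup (shift w) i)) ≡ 0
    otherRoots = suc-injective (trans (sym (numRoots-view v)) (≡ᵇ⇒≡ _ 1 (proj₁ (Equivalence.to T-∧ t))))

vertex1-not-own-parent : ∀ {n} (v : Vec (Maybe (Fin (suc n))) n) → isOneTwoTree (just zero ∷ v) ≡ false
vertex1-not-own-parent v = T-ext (λ t → decreasing-of-tree (just zero ∷ v) t zero) (λ ())

vertex1-childless : ∀ {n} x (v : Vec (Maybe (Fin (suc n))) n) i → lookup v i ≡ just zero →
                    isOneTwoTree (x ∷ v) ≡ false
vertex1-childless x v i e = T-ext
  (λ t → subst T (trans (decreasingAt-view (x ∷ v) (suc i)) (cong (belowParent _) e))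
                 (decreasing-of-tree (x ∷ v) t (suc i)))
  (λ ())

shifted-entries : ∀ m → map (M.map suc) (allMaybeFin m) ≡ nothing ∷ map just (tabulate {n = m} Fin.suc)
shifted-entries m = cong (nothing ∷_) (begin
  map (M.map suc) (map just (tabulate id))  ≡⟨ cong (map (M.map suc)) (map-tabulate id just) ⟩
  map (M.map suc) (tabulate just)           ≡⟨ map-tabulate just (M.map suc) ⟩
  tabulate (just ∘ Fin.suc)                     ≡⟨ sym (map-tabulate Fin.suc just) ⟩
  map just (tabulate Fin.suc)                   ∎)
  where open ≡-Reasoning

onTrees : ∀ {n} → (ParentMap n → ℕ) → ParentMap n → ℕ
onTrees G v = keepIf (isOneTwoTree v) (G v)

-- Fixing the parent entry x of vertex 1: the other vertices of a tree never have
-- vertex 1 as parent, so only shifted parent maps on [n] contribute.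
sum-with-first-entry : ∀ n (G : ParentMap (suc n) → ℕ) x →
  sum (map (λ v → onTrees G (x ∷ v)) (allVecs (allMaybeFin (suc n)) n))
    ≡ sum (map (λ w → onTrees G (x ∷ shift w)) (allParentMaps n))
sum-with-first-entry n G x = begin
  sum (map (λ v → onTrees G (x ∷ v)) (allVecs (allMaybeFin (suc n)) n))
    ≡⟨ sum-allVecs-avoid nothing (just zero) (map just (tabulate Fin.suc)) n (λ v → onTrees G (x ∷ v))
         (λ v i e → cong (λ b → keepIf b (G (x ∷ v))) (vertex1-childless x v i e)) ⟩
  sum (map (λ v → onTrees G (x ∷ v)) (allVecs (nothing ∷ map just (tabulate Fin.suc)) n))
    ≡⟨ cong (λ es → sum (map (λ v → onTrees G (x ∷ v)) (allVecs es n))) (sym (shifted-entries n)) ⟩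
  sum (map (λ v → onTrees G (x ∷ v)) (allVecs (map (M.map suc) (allMaybeFin n)) n))
    ≡⟨ sum-allVecs-map (M.map suc) (allMaybeFin n) n (λ v → onTrees G (x ∷ v)) ⟩
  sum (map (λ w → onTrees G (x ∷ shift w)) (allParentMaps n))  ∎
  where open ≡-Reasoning

sum-over-grafts : ∀ {n} (G : ParentMap (suc n) → ℕ) (w : ParentMap n) →
  sum (map (onTrees G ∘ graft w) (allFin n))
    ≡ keepIf (isOneTwoTree w) (sum (map (G ∘ graft w) (filterᵇ (hasRoom w) (allFin n))))
sum-over-grafts {n} G w = begin
  sum (map (onTrees G ∘ graft w) (allFin n))
    ≡⟨ sum-cong (λ p → trans (cong (λ b → keepIf b (G (graft w p))) (isOneTwoTree-graft w p))
                              (keepIf-∧ (isOneTwoTree w) (hasRoom w p) _)) (allFin n) ⟩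
  sum (map (λ p → keepIf (isOneTwoTree w) (keepIf (hasRoom w p) (G (graft w p)))) (allFin n))
    ≡⟨ keepIf-sum (isOneTwoTree w) _ (allFin n) ⟩
  keepIf (isOneTwoTree w) (sum (map (λ p → keepIf (hasRoom w p) (G (graft w p))) (allFin n)))
    ≡⟨ cong (keepIf (isOneTwoTree w)) (sym (sum-filterᵇ (hasRoom w) (G ∘ graft w) (allFin n))) ⟩
  keepIf (isOneTwoTree w) (sum (map (G ∘ graft w) (filterᵇ (hasRoom w) (allFin n))))  ∎
  where open ≡-Reasoning

-- Stated for sums of an arbitrary statistic G:
-- split by the parent entry of vertex 1, which is a vertex p + 1 of the rest.
sum-over-trees-by-graft : ∀ m (G : ParentMap (suc (suc m)) → ℕ) →
  sum (map G (oneTwoTrees (suc (suc m))))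
    ≡ sum (map (λ w → sum (map (G ∘ graft w) (filterᵇ (hasRoom w) (allFin (suc m))))) (oneTwoTrees (suc m)))
sum-over-trees-by-graft m G = begin
  sum (map G (oneTwoTrees (suc k)))
    ≡⟨ sum-filterᵇ isOneTwoTree G (allParentMaps (suc k)) ⟩
  sum (map (onTrees G) (allParentMaps (suc k)))
    ≡⟨ sum-allVecs-suc (allMaybeFin (suc k)) k (onTrees G) ⟩
  byFirstEntry nothing + (byFirstEntry (just zero) + sum (map byFirstEntry (map just (tabulate Fin.suc))))
    ≡⟨ cong₂ (λ a b → a + (b + sum (map byFirstEntry (map just (tabulate Fin.suc))))) rootless selfParent ⟩
  sum (map byFirstEntry (map just (tabulate Fin.suc)))
    ≡⟨ trans (sum-map byFirstEntry just (tabulate Fin.suc)) (cong sum (map-tabulate Fin.suc (byFirstEntry ∘ just))) ⟩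
  sum (tabulate (λ p → byFirstEntry (just (suc p))))
    ≡⟨ trans (cong sum (tabulate-cong (λ p → sum-with-first-entry k G (just (suc p)))))
             (sym (cong sum (map-tabulate id graftsAt))) ⟩
  sum (map graftsAt (allFin k))
    ≡⟨ sum-swap (λ p w → onTrees G (graft w p)) (allFin k) (allParentMaps k) ⟩
  sum (map (λ w → sum (map (onTrees G ∘ graft w) (allFin k))) (allParentMaps k))
    ≡⟨ sum-cong (sum-over-grafts G) (allParentMaps k) ⟩
  sum (map (λ w → keepIf (isOneTwoTree w) (overRoom w)) (allParentMaps k))
    ≡⟨ sym (sum-filterᵇ isOneTwoTree overRoom (allParentMaps k)) ⟩
  sum (map overRoom (oneTwoTrees k))  ∎
  where
  open ≡-Reasoning
  k = suc m
  byFirstEntry : Maybe (Fin (suc k)) → ℕ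
  byFirstEntry x = sum (map (λ v → onTrees G (x ∷ v)) (allVecs (allMaybeFin (suc k)) k))
  graftsAt : Fin k → ℕ
  graftsAt p = sum (map (λ w → onTrees G (graft w p)) (allParentMaps k))
  overRoom : ParentMap k → ℕ
  overRoom w = sum (map (G ∘ graft w) (filterᵇ (hasRoom w) (allFin k)))
  rootless : byFirstEntry nothing ≡ 0
  rootless = trans (sum-with-first-entry k G nothing)
    (sum-zero (λ w → cong (λ b → keepIf b (G (nothing ∷ shift w))) (vertex1-not-root w)) (allParentMaps k))
  selfParent : byFirstEntry (just zero) ≡ 0
  selfParent = sum-zero (λ v → cong (λ b → keepIf b (G (just zero ∷ v))) (vertex1-not-own-parent v))
                        (allVecs (allMaybeFin (suc k)) k)

every-tree-is-a-graft : ∀ m (P : ParentMap (suc (suc m)) → Set) → Decidable P →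
  All (λ w → ∀ p → T (hasRoom w p) → P (graft w p)) (oneTwoTrees (suc m)) →
  All P (oneTwoTrees (suc (suc m)))
every-tree-is-a-graft m P P? graftsOK =
  All.map failure⇒P (sum-zero⁻ (oneTwoTrees (suc (suc m))) noFailures)
  where
  failure : ParentMap (suc (suc m)) → ℕ
  failure v = 𝟙 (not (does (P? v)))
  P⇒no-failure : ∀ {v} → P v → failure v ≡ 0
  P⇒no-failure {v} pv with P? v
  ... | yes _  = refl
  ... | no ¬pv = ⊥-elim (¬pv pv)
  failure⇒P : ∀ {v} → failure v ≡ 0 → P v
  failure⇒P {v} e with P? v
  ... | yes pv = pv
  failure⇒P () | no _
  noFailureAt : ∀ w → (∀ p → T (hasRoom w p) → P (graft w p)) →
                ∀ p → keepIf (hasRoom w p) (failure (graft w p)) ≡ 0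
  noFailureAt w ok p with hasRoom w p | ok p
  ... | true  | okp = P⇒no-failure (okp tt)
  ... | false | _   = refl
  noFailures : sum (map failure (oneTwoTrees (suc (suc m)))) ≡ 0
  noFailures = trans (sum-over-trees-by-graft m failure)
    (sum-zeroAll (All.map (λ {w} ok →
        trans (sum-filterᵇ (hasRoom w) (failure ∘ graft w) (allFin (suc m)))
              (sum-zero (noFailureAt w ok) (allFin (suc m)))) graftsOK))

room-cases : ∀ {n} (w : ParentMap n) p → T (hasRoom w p) → numChildren w p ≡ 0 ⊎ numChildren w p ≡ 1
room-cases w p room with numChildren w p
... | zero       = inj₁ refl
... | suc zero   = inj₂ refl

-- In a 1-2 tree on [n] (n ≥ 1) the leaves and unary vertices satisfy 2L + U = n + 1
-- (the edge count U + 2B = n − 1 together with L + U + B = n); proved by induction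
-- along grafts.
Balanced : ∀ {n} → ParentMap n → Set
Balanced {n} v = 2 * numLeaves v + numUnary v ≡ suc n

leaf-unary-balance : ∀ m → All Balanced (oneTwoTrees (suc m))
leaf-unary-balance zero    = refl ∷ []
leaf-unary-balance (suc m) =
  every-tree-is-a-graft m Balanced (λ v → 2 * numLeaves v + numUnary v ≟ℕ suc (suc (suc m)))
    (All.map (λ {w} → preserved {w}) (leaf-unary-balance m))
  where
  preserved : ∀ {w} → Balanced w → ∀ p → T (hasRoom w p) → Balanced (graft w p)
  preserved {w} balanced p room with room-cases w p room
  ... | inj₁ leaf  with graft-at-leaf w p leaf
  ...   | sameL , moreU =
    trans (cong₂ (λ l u → 2 * l + u) sameL moreU) (trans (+-suc _ _) (cong suc balanced))
  preserved {w} balanced p room | inj₂ unary with graft-at-unary w p unary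
  ...   | moreL , lessU =
    trans (cong (λ l → 2 * l + numUnary (graft w p)) moreL)
          (trans (leaf-for-unary (numLeaves w) (numUnary (graft w p)))
                 (cong suc (trans (cong (2 * numLeaves w +_) lessU) balanced)))
    where
    leaf-for-unary : ∀ l u → 2 * suc l + u ≡ suc (2 * l + suc u)
    leaf-for-unary = solve-∀

-- Recursion for sums of a function of the leaf number: a tree w on [m+1]
-- contributes L copies of f L (grafts below a leaf) and U copies of f (L + 1).
sum-over-trees-by-leaves : ∀ m (f : ℕ → ℕ) →
  sum (map (f ∘ numLeaves) (oneTwoTrees (suc (suc m))))
    ≡ sum (map (λ w → numLeaves w * f (numLeaves w) + numUnary w * f (suc (numLeaves w))) (oneTwoTrees (suc m)))
sum-over-trees-by-leaves m f =
  trans (sum-over-trees-by-graft m (f ∘ numLeaves))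
        (sum-cong (λ w → sum-over-room w (f ∘ numLeaves) _ _
                           (λ p leaf  → cong f (proj₁ (graft-at-leaf w p leaf)))
                           (λ p unary → cong f (proj₁ (graft-at-unary w p unary))))
                  (oneTwoTrees (suc m)))

-- Weighting a tree on [n] with L leaves by 2^(n − L) makes the recursion exact:
-- X_n = Σ 2^(n−L) and Y_n = Σ 2^(n−L)·L satisfy first-order recurrences.
weight : ℕ → ℕ → ℕ
weight n l = 2 ^ (n ∸ l)

weightedCount : ℕ → ℕ
weightedCount n = sum (map (weight n ∘ numLeaves) (oneTwoTrees n))

weightedLeaves : ℕ → ℕ
weightedLeaves n = sum (map (λ v → weight n (numLeaves v) * numLeaves v) (oneTwoTrees n))

-- A balanced tree on [n] has at most n leaves, so n − L does not truncate.
leaves≤ : ∀ {n} (v : ParentMap n) → Balanced v → numLeaves v ≤ n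
leaves≤ {n} v balanced = bound (numLeaves v) (numUnary v) balanced
  where
  bound : ∀ l u → 2 * l + u ≡ suc n → l ≤ n
  bound zero    u e = z≤n
  bound (suc l) u e = subst (suc l ≤_) (suc-injective (trans (sym (regroup l u)) e)) (m≤m+n (suc l) (l + u))
    where regroup : ∀ l u → 2 * suc l + u ≡ suc (suc l + (l + u))
          regroup = solve-∀

weight-suc : ∀ n l → l ≤ n → weight (suc n) l ≡ 2 * weight n l
weight-suc n l l≤n = cong (2 ^_) (+-∸-assoc 1 l≤n)

weightedCount-suc : ∀ m → weightedCount (suc (suc m)) ≡ suc (suc m) * weightedCount (suc m)
weightedCount-suc m =
  trans (sum-over-trees-by-leaves m (weight (suc n)))
        (trans (sum-congAll (All.map (λ {w} → perTree {w}) (leaf-unary-balance m)))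
               (sum-*ˡ (suc n) (weight n ∘ numLeaves) (oneTwoTrees n)))
  where
  n = suc m
  perTree : ∀ {w : ParentMap n} → Balanced w →
    numLeaves w * weight (suc n) (numLeaves w) + numUnary w * weight (suc n) (suc (numLeaves w))
      ≡ suc n * weight n (numLeaves w)
  perTree {w} balanced rewrite weight-suc n (numLeaves w) (leaves≤ w balanced) =
    trans (collect (numLeaves w) (numUnary w) (weight n (numLeaves w)))
          (cong (_* weight n (numLeaves w)) balanced)
    where
    collect : ∀ l u E → l * (2 * E) + u * E ≡ (2 * l + u) * E
    collect = solve-∀

weightedLeaves-suc : ∀ m →
  weightedLeaves (suc (suc m)) ≡ m * weightedLeaves (suc m) + suc (suc m) * weightedCount (suc m)
weightedLeaves-suc m =
  trans (sum-over-trees-by-leaves m (λ l → weight (suc n) l * l))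
        (trans (sum-congAll (All.map (λ {w} → perTree {w}) (leaf-unary-balance m)))
               (trans (sum-+ (λ w → m * (weight n (numLeaves w) * numLeaves w)) (λ w → suc n * weight n (numLeaves w)) (oneTwoTrees n))
                      (cong₂ _+_ (sum-*ˡ m (λ w → weight n (numLeaves w) * numLeaves w) (oneTwoTrees n))
                                 (sum-*ˡ (suc n) (weight n ∘ numLeaves) (oneTwoTrees n)))))
  where
  n = suc m
  perTree : ∀ {w : ParentMap n} → Balanced w →
    numLeaves w * (weight (suc n) (numLeaves w) * numLeaves w)
      + numUnary w * (weight (suc n) (suc (numLeaves w)) * suc (numLeaves w))
      ≡ m * (weight n (numLeaves w) * numLeaves w) + suc n * weight n (numLeaves w)
  perTree {w} balanced rewrite weight-suc n (numLeaves w) (leaves≤ w balanced) = begin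
    l * (2 * E * l) + u * (E * suc l)  ≡⟨ factor l u E ⟩
    E * (l * (2 * l + u) + u)          ≡⟨ cong (λ s → E * (l * s + u)) balanced ⟩
    E * (l * suc n + u)                ≡⟨ expand l u E m ⟩
    m * (E * l) + (2 * l + u) * E      ≡⟨ cong (λ s → m * (E * l) + s * E) balanced ⟩
    m * (E * l) + suc n * E            ∎
    where
    open ≡-Reasoning
    l = numLeaves w
    u = numUnary w
    E = weight n l
    factor : ∀ l u E → l * (2 * E * l) + u * (E * suc l) ≡ E * (l * (2 * l + u) + u)
    factor = solve-∀
    expand : ∀ l u E m → E * (l * suc (suc m) + u) ≡ m * (E * l) + (2 * l + u) * E
    expand = solve-∀

weightedCount-pos : ∀ m → weightedCount (suc m) > 0
weightedCount-pos zero    = s≤s z≤n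
weightedCount-pos (suc m) =
  subst (0 <_) (sym (weightedCount-suc m))
        (<-≤-trans (weightedCount-pos m) (m≤n*m (weightedCount (suc m)) (suc (suc m))))

weighted-mean-bound : ∀ m → suc m * weightedCount (suc m) ≤ 4 * weightedLeaves (suc m)
weighted-mean-bound zero    = s≤s z≤n
weighted-mean-bound (suc m) = begin
  suc (suc m) * weightedCount (suc (suc m))
    ≡⟨ cong (suc (suc m) *_) (weightedCount-suc m) ⟩
  suc (suc m) * (suc (suc m) * X)
    ≤⟨ m≤m+n _ ((m + 4) * X) ⟩
  suc (suc m) * (suc (suc m) * X) + (m + 4) * X
    ≡⟨ regroup m X ⟩
  m * (suc m * X) + 4 * (suc (suc m) * X)
    ≤⟨ +-monoˡ-≤ (4 * (suc (suc m) * X)) (*-monoʳ-≤ m (weighted-mean-bound m)) ⟩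
  m * (4 * Y) + 4 * (suc (suc m) * X)
    ≡⟨ factor m Y X ⟩
  4 * (m * Y + suc (suc m) * X)
    ≡⟨ cong (4 *_) (weightedLeaves-suc m) ⟨
  4 * weightedLeaves (suc (suc m))  ∎
  where
  open ≤-Reasoning
  X = weightedCount (suc m)
  Y = weightedLeaves (suc m)
  regroup : ∀ m X → suc (suc m) * (suc (suc m) * X) + (m + 4) * X ≡ m * (suc m * X) + 4 * (suc (suc m) * X)
  regroup = solve-∀
  factor : ∀ m Y X → m * (4 * Y) + 4 * (suc (suc m) * X) ≡ 4 * (m * Y + suc (suc m) * X)
  factor = solve-∀

rearrangement : ∀ {wa wb a b} → wb ≤ wa → a ≤ b → wa * a + wb * b ≤ wa * b + wb * a
rearrangement {wb = wb} {a = a} wb≤wa a≤b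
  with e , refl ← m≤n⇒∃[o]m+o≡n wb≤wa | d , refl ← m≤n⇒∃[o]m+o≡n a≤b =
  ≤-trans (m≤m+n _ (e * d)) (≤-reflexive (cross-term wb e a d))
  where
  cross-term : ∀ wb e a d → (wb + e) * a + wb * (a + d) + e * d ≡ (wb + e) * (a + d) + wb * a
  cross-term = solve-∀

Antitone : (ℕ → ℕ) → Set
Antitone w = ∀ {a b} → a ≤ b → w b ≤ w a

weight-antitone : ∀ n → Antitone (weight n)
weight-antitone n l≤l′ = ^-monoʳ-≤ 2 (∸-monoʳ-≤ n l≤l′)

opposite-pair : (w : ℕ → ℕ) → Antitone w → ∀ a b → w a * a + w b * b ≤ w a * b + w b * a
opposite-pair w anti a b with ≤-total a b
... | inj₁ a≤b = rearrangement (anti a≤b) a≤b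
... | inj₂ b≤a = subst₂ _≤_ (+-comm (w b * b) (w a * a)) (+-comm (w b * a) (w a * b))
                        (rearrangement (anti b≤a) b≤a)

module _ {A : Set} (w : ℕ → ℕ) (anti : Antitone w) (h : A → ℕ) where

  chebyshev : (xs : List A) →
    length xs * sum (map (λ x → w (h x) * h x) xs) ≤ sum (map (w ∘ h) xs) * sum (map h xs)
  chebyshev []       = z≤n
  chebyshev (x ∷ xs) = begin
    suc n * (α * a + P)                 ≡⟨ expand-left α a n P ⟩
    α * a + (n * (α * a) + P) + n * P   ≤⟨ +-mono-≤ (+-monoʳ-≤ (α * a) cross) (chebyshev xs) ⟩
    α * a + (α * H + W * a) + W * H     ≡⟨ expand-right α a W H ⟨
    (α + W) * (a + H)                   ∎
    where
    open ≤-Reasoning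
    a = h x
    α = w a
    n = length xs
    P = sum (map (λ y → w (h y) * h y) xs)
    W = sum (map (w ∘ h) xs)
    H = sum (map h xs)
    cross : n * (α * a) + P ≤ α * H + W * a
    cross = subst₂ _≤_
      (trans (sum-+ (λ _ → α * a) (λ y → w (h y) * h y) xs) (cong (_+ P) (sum-const (α * a) xs)))
      (trans (sum-+ (λ y → α * h y) (λ y → w (h y) * a) xs) (cong₂ _+_ (sum-*ˡ α h xs) (sum-*ʳ a (w ∘ h) xs)))
      (sum-mono (λ y → opposite-pair w anti a (h y)) xs)
    expand-left : ∀ α a n P → suc n * (α * a + P) ≡ α * a + (n * (α * a) + P) + n * P
    expand-left = solve-∀
    expand-right : ∀ α a W H → (α + W) * (a + H) ≡ α * a + (α * H + W * a) + W * H
    expand-right = solve-∀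

-- The theorem: n·#T ≤ 4·ΣL.  Multiply by X_n > 0: X·n·#T ≤ 4·Y·#T by the weighted
-- bound, and #T·Y ≤ X·ΣL by Chebyshev with the antitone weight 2^(n−L).
proposition2p10 : (n : ℕ) → n > 0 →
    n * length (oneTwoTrees n) ≤ 4 * sum (map numLeaves (oneTwoTrees n))
proposition2p10 zero    ()
proposition2p10 (suc m) _ = *-cancelˡ-≤ X {{>-nonZero (weightedCount-pos m)}} (begin
  X * (n * #T)   ≡⟨ shuffle₁ X n #T ⟩
  n * X * #T     ≤⟨ *-monoˡ-≤ #T (weighted-mean-bound m) ⟩
  4 * Y * #T     ≡⟨ shuffle₂ Y #T ⟩
  4 * (#T * Y)   ≤⟨ *-monoʳ-≤ 4 (chebyshev (weight n) (weight-antitone n) numLeaves trees) ⟩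
  4 * (X * L)    ≡⟨ shuffle₃ X L ⟩
  X * (4 * L)    ∎)
  where
  open ≤-Reasoning
  n = suc m
  trees = oneTwoTrees n
  #T = length trees
  X = weightedCount n
  Y = weightedLeaves n
  L = sum (map numLeaves trees)
  shuffle₁ : ∀ X n T → X * (n * T) ≡ n * X * T
  shuffle₁ = solve-∀
  shuffle₂ : ∀ Y T → 4 * Y * T ≡ 4 * (T * Y)
  shuffle₂ = solve-∀
  shuffle₃ : ∀ X L → 4 * (X * L) ≡ X * (4 * L)
  shuffle₃ = solve-∀
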